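{- For all integers $n$, $$f(n,x,s)^2-(x^2+qs)f(n-1,x,qs)^2-qs(x^2+qs)f(n-2,x,q^2s)^2+q^5s^3f(n-3,x,q^3s)^2=0 .$$
   Context: The (Carlitz) $q$-Fibonacci polynomials $f(n,x,s)$ are defined by $f(n,x,s)=xf(n-1,x,s)+q^{n-2}sf(n-2,x,s)$ with $f(0,x,s)=0$, $f(1,x,s)=1$. The same recurrence, run backwards, extends the definition to all integers $n$ (the values are then rational functions in $x,s,q$); the recurrence holds for all $n\in\mathbb{Z}$. -}

module Defs where

open import Level using (Level)
open import Data.Nat using (ℕ; zero; suc)
open import Data.Integer using (ℤ; +_; -[1+_])
open import Algebra.Bundles using (CommutativeRing)

-- The parameter s must be invertible (its
-- inverse s⁻ is passed explicitly) so that the recurrence can be run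
-- backwards:  f(n-2) = q^{-(n-2)} s⁻¹ (f(n) - x f(n-1)).
module QFib {c ℓ : Level} (R : CommutativeRing c ℓ) where
  open CommutativeRing R public

  pow : Carrier → ℕ → Carrier
  pow a zero    = 1#
  pow a (suc k) = a * pow a k

  fPos : (q x s : Carrier) → ℕ → Carrier
  fPos q x s zero          = 0#
  fPos q x s (suc zero)    = 1#
  fPos q x s (suc (suc n)) = x * fPos q x s (suc n) + (pow q n * s) * fPos q x s n

  -- fNeg k = f(-k): the recurrence at index n = 2-k gives
  -- f(-k) = q^k s⁻¹ (f(2-k) - x f(1-k)).
  fNeg : (q x s⁻ : Carrier) → ℕ → Carrier
  fNeg q x s⁻ zero          = 0#
  fNeg q x s⁻ (suc zero)    = (pow q 1 * s⁻) * (1# - x * 0#)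
  fNeg q x s⁻ (suc (suc k)) = (pow q (suc (suc k)) * s⁻) * (fNeg q x s⁻ k - x * fNeg q x s⁻ (suc k))

  f : (q : Carrier) → ℤ → (x s s⁻ : Carrier) → Carrier
  f q (+ n)      x s s⁻ = fPos q x s n
  f q -[1+ k ]   x s s⁻ = fNeg q x s⁻ (suc k)

-- The key fact is a second recurrence, shifting s instead of n:
--   f(n, x, s) = x f(n-1, x, qs) + qs f(n-2, x, q²s)      (n ∈ ℤ).
-- Applied at n and at n-1 it expresses f(n, x, s) and f(n-1, x, qs) through
-- h₂ = f(n-2, x, q²s) and h₃ = f(n-3, x, q³s), after which the theorem is a
-- polynomial identity in x, q, s, h₂, h₃.
-- For n ≥ 2 the shifted recurrence follows by induction from the recurrence in n;
-- for n ≤ 1 by induction downwards along the backward recurrence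
-- f(n-2) = q^{2-n} s⁻¹ (f(n) - x f(n-1)): once q q⁻ = 1 is used, the three
-- sequences f(·, x, s), f(·-1, x, qs), f(·-2, x, q²s) share its coefficient.
module Submission where

open import Defs
open import Level using (Level)
open import Data.Integer using (ℤ; +_) renaming (_-_ to _-ℤ_)
open import Algebra.Bundles using (CommutativeRing)
open import Data.Nat using (ℕ; zero; suc)
open import Data.Integer using (-[1+_])
import Data.Nat.Properties as ℕ
import Data.Integer.Properties as ℤ
import Relation.Binary.PropositionalEquality as ≡
open ≡ using (_≡_)
import Algebra.Properties.Ring as RingProperties
import Algebra.Solver.Ring.NaturalCoefficients.Default as SemiringSolver
import Relation.Binary.Reasoning.Setoid as SetoidReasoning

module Carlitz {c ℓ : Level} (R : CommutativeRing c ℓ) where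
  open QFib R
  open RingProperties ring using (-‿distribˡ-*; -‿+-comm)
  open SemiringSolver commutativeSemiring using (solve; _:=_; _:+_; _:*_; _:^_; con)
  open SetoidReasoning setoid

  *-distrib-minus : ∀ u a x b → u * (a - x * b) ≈ u * a + u * - x * b
  *-distrib-minus u a x b = begin
    u * (a - x * b)          ≈⟨ distribˡ u a (- (x * b)) ⟩
    u * a + u * - (x * b)    ≈⟨ +-congˡ (*-congˡ (-‿distribˡ-* x b)) ⟩
    u * a + u * (- x * b)    ≈⟨ +-congˡ (sym (*-assoc u (- x) b)) ⟩
    u * a + u * - x * b      ∎

  a+d≈b+c⇒a-b-c+d≈0 : ∀ {a b c d} → a + d ≈ b + c → a - b - c + d ≈ 0#
  a+d≈b+c⇒a-b-c+d≈0 {a} {b} {c} {d} eq = begin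
    a - b - c + d            ≈⟨ solve 4 (λ a b′ c′ d → a :+ b′ :+ c′ :+ d := a :+ d :+ (b′ :+ c′))
                                  refl a (- b) (- c) d ⟩
    a + d + (- b + - c)      ≈⟨ +-cong eq (-‿+-comm b c) ⟩
    b + c + - (b + c)        ≈⟨ -‿inverseʳ (b + c) ⟩
    0#                       ∎

  *-inverse : ∀ {a a⁻ b b⁻} → a * a⁻ ≈ 1# → b * b⁻ ≈ 1# → (a * b) * (a⁻ * b⁻) ≈ 1#
  *-inverse {a} {a⁻} {b} {b⁻} aa⁻ bb⁻ = begin
    (a * b) * (a⁻ * b⁻)      ≈⟨ solve 4 (λ a a⁻ b b⁻ → (a :* b) :* (a⁻ :* b⁻) := (a :* a⁻) :* (b :* b⁻))
                                  refl a a⁻ b b⁻ ⟩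
    (a * a⁻) * (b * b⁻)      ≈⟨ *-cong aa⁻ bb⁻ ⟩
    1# * 1#                  ≈⟨ *-identityˡ 1# ⟩
    1#                       ∎

  pow-suc-cancel : ∀ {q q⁻} → q * q⁻ ≈ 1# → ∀ k a → pow q (suc k) * (q⁻ * a) ≈ pow q k * a
  pow-suc-cancel {q} {q⁻} qq⁻ k a = begin
    pow q (suc k) * (q⁻ * a) ≈⟨ solve 4 (λ q q⁻ Q a → (q :* Q) :* (q⁻ :* a) := (q :* q⁻) :* (Q :* a))
                                  refl q q⁻ (pow q k) a ⟩
    (q * q⁻) * (pow q k * a) ≈⟨ *-congʳ qq⁻ ⟩
    1# * (pow q k * a)       ≈⟨ *-identityˡ _ ⟩
    pow q k * a              ∎

  fPos-cong : ∀ q x {s s′} → s ≈ s′ → ∀ k → fPos q x s k ≈ fPos q x s′ k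
  fPos-cong q x s≈s′ zero          = refl
  fPos-cong q x s≈s′ (suc zero)    = refl
  fPos-cong q x s≈s′ (suc (suc k)) =
    +-cong (*-congˡ (fPos-cong q x s≈s′ (suc k))) (*-cong (*-congˡ s≈s′) (fPos-cong q x s≈s′ k))

  fNeg-cong : ∀ q x {t t′} → t ≈ t′ → ∀ k → fNeg q x t k ≈ fNeg q x t′ k
  fNeg-cong q x t≈t′ zero          = refl
  fNeg-cong q x t≈t′ (suc zero)    = *-congʳ (*-congˡ t≈t′)
  fNeg-cong q x t≈t′ (suc (suc k)) =
    *-cong (*-congˡ t≈t′) (+-cong (fNeg-cong q x t≈t′ k) (-‿cong (*-congˡ (fNeg-cong q x t≈t′ (suc k)))))

  f-cong : ∀ q x {m n s s′ t t′} → m ≡ n → s ≈ s′ → t ≈ t′ → f q m x s t ≈ f q n x s′ t′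
  f-cong q x {+ k}      ≡.refl s≈s′ t≈t′ = fPos-cong q x s≈s′ k
  f-cong q x { -[1+ k ]} ≡.refl s≈s′ t≈t′ = fNeg-cong q x t≈t′ (suc k)

  fPos-shift : ∀ q x s k →
    fPos q x s (suc (suc k)) ≈ x * fPos q x (q * s) (suc k) + (q * s) * fPos q x (q * (q * s)) k
  fPos-shift q x s zero =
    solve 3 (λ x q s → x :* con 1 :+ (con 1 :* s) :* con 0 := x :* con 1 :+ (q :* s) :* con 0) refl x q s
  fPos-shift q x s (suc zero) =
    solve 3 (λ x q s → x :* (x :* con 1 :+ (con 1 :* s) :* con 0) :+ ((q :* con 1) :* s) :* con 1
                    := x :* (x :* con 1 :+ (con 1 :* (q :* s)) :* con 0) :+ (q :* s) :* con 1)
      refl x q s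
  fPos-shift q x s (suc (suc k)) = begin
    x * P s (suc (suc (suc k))) + (pow q (suc (suc k)) * s) * P s (suc (suc k))
      ≈⟨ +-cong (*-congˡ (fPos-shift q x s (suc k))) (*-congˡ (fPos-shift q x s k)) ⟩
    x * (x * a₂ + (q * s) * b₁) + (pow q (suc (suc k)) * s) * (x * a₁ + (q * s) * b₀)
      ≈⟨ solve 8 (λ x q s Q a₂ a₁ b₁ b₀ →
           x :* (x :* a₂ :+ (q :* s) :* b₁) :+ ((q :* (q :* Q)) :* s) :* (x :* a₁ :+ (q :* s) :* b₀)
           := x :* (x :* a₂ :+ ((q :* Q) :* (q :* s)) :* a₁)
              :+ (q :* s) :* (x :* b₁ :+ (Q :* (q :* (q :* s))) :* b₀))
         refl x q s (pow q k) a₂ a₁ b₁ b₀ ⟩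
    x * P (q * s) (suc (suc (suc k))) + (q * s) * P (q * (q * s)) (suc (suc k))  ∎
    where
    P = fPos q x
    a₂ = P (q * s) (suc (suc k))
    a₁ = P (q * s) (suc k)
    b₁ = P (q * (q * s)) (suc k)
    b₀ = P (q * (q * s)) k

  -- fDesc q x t k is f(1 - k, x, s) for every s with inverse t.
  fDesc : (q x t : Carrier) → ℕ → Carrier
  fDesc q x t zero          = 1#
  fDesc q x t (suc zero)    = 0#
  fDesc q x t (suc (suc k)) = fNeg q x t (suc k)

  -- The subtraction in fNeg is rewritten with - x as a factor, so that the
  -- identities below are commutative-semiring identities in x and - x.
  fDesc-rec : ∀ q x t k {u} → pow q (suc k) * t ≈ u →
    fDesc q x t (suc (suc k)) ≈ u * fDesc q x t k + u * - x * fDesc q x t (suc k)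
  fDesc-rec q x t k u≈ = trans (unfold k) (+-cong (*-congʳ u≈) (*-congʳ (*-congʳ u≈)))
    where
    unfold : ∀ k → fDesc q x t (suc (suc k)) ≈
      pow q (suc k) * t * fDesc q x t k + pow q (suc k) * t * - x * fDesc q x t (suc k)
    unfold zero          = *-distrib-minus _ _ x _
    unfold (suc zero)    = *-distrib-minus _ _ x _
    unfold (suc (suc k)) = *-distrib-minus _ _ x _

  module Shift {q q⁻ : Carrier} (qq⁻ : q * q⁻ ≈ 1#) (x : Carrier)
               {s t : Carrier} (st : s * t ≈ 1#) where

    private
      t′ t″ : Carrier
      t′ = q⁻ * t
      t″ = q⁻ * t′

      pow-cancel₂ : ∀ k a → pow q (suc (suc k)) * (q⁻ * (q⁻ * a)) ≈ pow q k * a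
      pow-cancel₂ k a = trans (pow-suc-cancel qq⁻ (suc k) (q⁻ * a)) (pow-suc-cancel qq⁻ k a)

      qt″≈t′ : pow q 1 * t″ ≈ t′
      qt″≈t′ = trans (pow-suc-cancel qq⁻ 0 t′) (*-identityˡ t′)

      qt′≈t : pow q 1 * t′ ≈ t
      qt′≈t = trans (pow-suc-cancel qq⁻ 0 t) (*-identityˡ t)

      q²t″≈t : pow q 2 * t″ ≈ t
      q²t″≈t = trans (pow-cancel₂ 0 t) (*-identityˡ t)

    fDesc-shift-zero : 1# ≈ x * 0# + (q * s) * fDesc q x t″ 2
    fDesc-shift-zero = sym (begin
      x * 0# + (q * s) * fDesc q x t″ 2
        ≈⟨ +-congˡ (*-congˡ (fDesc-rec q x t″ 0 qt″≈t′)) ⟩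
      x * 0# + (q * s) * (t′ * 1# + t′ * - x * 0#)
        ≈⟨ solve 6 (λ x y q s q⁻ t →
             x :* con 0 :+ (q :* s) :* ((q⁻ :* t) :* con 1 :+ (q⁻ :* t) :* y :* con 0)
             := (q :* s) :* (q⁻ :* t))
           refl x (- x) q s q⁻ t ⟩
      (q * s) * (q⁻ * t)
        ≈⟨ *-inverse qq⁻ st ⟩
      1#  ∎)

    fDesc-shift-one : 0# ≈ x * fDesc q x t′ 2 + (q * s) * fDesc q x t″ 3
    fDesc-shift-one = sym (begin
      x * fDesc q x t′ 2 + (q * s) * fDesc q x t″ 3
        ≈⟨ +-cong (*-congˡ (fDesc-rec q x t′ 0 qt′≈t))
                  (*-congˡ (trans (fDesc-rec q x t″ 1 q²t″≈t)
                                  (+-congˡ (*-congˡ (fDesc-rec q x t″ 0 qt″≈t′))))) ⟩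
      x * (t * 1# + t * - x * 0#) + (q * s) * (t * 0# + t * - x * (t′ * 1# + t′ * - x * 0#))
        ≈⟨ solve 6 (λ x y q s q⁻ t →
             x :* (t :* con 1 :+ t :* y :* con 0)
               :+ (q :* s) :* (t :* con 0 :+ t :* y :* ((q⁻ :* t) :* con 1 :+ (q⁻ :* t) :* y :* con 0))
             := (x :+ y :* ((q :* s) :* (q⁻ :* t))) :* t)
           refl x (- x) q s q⁻ t ⟩
      (x + - x * ((q * s) * (q⁻ * t))) * t
        ≈⟨ *-congʳ (+-congˡ (trans (*-congˡ (*-inverse qq⁻ st)) (*-identityʳ (- x)))) ⟩
      (x + - x) * t
        ≈⟨ *-congʳ (-‿inverseʳ x) ⟩
      0# * t
        ≈⟨ zeroˡ t ⟩
      0#  ∎)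

    fDesc-shift : ∀ k → fDesc q x t k ≈ x * fDesc q x t′ (suc k) + (q * s) * fDesc q x t″ (suc (suc k))
    fDesc-shift zero          = fDesc-shift-zero
    fDesc-shift (suc zero)    = fDesc-shift-one
    fDesc-shift (suc (suc k)) = begin
      fDesc q x t (suc (suc k))
        ≈⟨ fDesc-rec q x t k refl ⟩
      u * a₀ + u * - x * a₁
        ≈⟨ +-cong (*-congˡ (fDesc-shift k)) (*-congˡ (fDesc-shift (suc k))) ⟩
      u * (x * b₁ + (q * s) * c₂) + u * - x * (x * b₂ + (q * s) * c₃)
        ≈⟨ solve 8 (λ x y qs u b₁ b₂ c₂ c₃ →
             u :* (x :* b₁ :+ qs :* c₂) :+ u :* y :* (x :* b₂ :+ qs :* c₃)
             := x :* (u :* b₁ :+ u :* y :* b₂) :+ qs :* (u :* c₂ :+ u :* y :* c₃))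
           refl x (- x) (q * s) u b₁ b₂ c₂ c₃ ⟩
      x * (u * b₁ + u * - x * b₂) + (q * s) * (u * c₂ + u * - x * c₃)
        ≈⟨ sym (+-cong (*-congˡ (fDesc-rec q x t′ (suc k) (pow-suc-cancel qq⁻ (suc k) t)))
                       (*-congˡ (fDesc-rec q x t″ (suc (suc k)) (pow-cancel₂ (suc k) t)))) ⟩
      x * fDesc q x t′ (suc (suc (suc k))) + (q * s) * fDesc q x t″ (suc (suc (suc (suc k))))  ∎
      where
      u = pow q (suc k) * t
      a₀ = fDesc q x t k
      a₁ = fDesc q x t (suc k)
      b₁ = fDesc q x t′ (suc k)
      b₂ = fDesc q x t′ (suc (suc k))
      c₂ = fDesc q x t″ (suc (suc k))
      c₃ = fDesc q x t″ (suc (suc (suc k)))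

    f-shift : ∀ n → f q n x s t ≈ x * f q (n -ℤ + 1) x (q * s) t′ + (q * s) * f q (n -ℤ + 2) x (q * (q * s)) t″
    f-shift (+ suc (suc k)) = fPos-shift q x s k
    f-shift (+ 1)           = fDesc-shift 0
    f-shift (+ 0)           = fDesc-shift 1
    -- Here n -ℤ + 1 and n -ℤ + 2 reduce to -[1+ suc (j + 0) ] and -[1+ suc (j + 1) ].
    f-shift -[1+ j ] rewrite ℕ.+-identityʳ j | ℕ.+-comm j 1 = fDesc-shift (suc (suc j))

  pow²-* : ∀ a b → a * (a * b) ≈ pow a 2 * b
  pow²-* = solve 2 (λ a b → a :* (a :* b) := a :^ 2 :* b) refl

  pow³-* : ∀ a b → a * (a * (a * b)) ≈ pow a 3 * b
  pow³-* = solve 2 (λ a b → a :* (a :* (a :* b)) := a :^ 3 :* b) refl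

  squares-vanish : ∀ {x q s h₀ h₁ h₂ h₃} →
    h₀ ≈ x * h₁ + (q * s) * h₂ → h₁ ≈ x * h₂ + (q * (q * s)) * h₃ →
    h₀ * h₀ - (x * x + q * s) * (h₁ * h₁) - ((q * s) * (x * x + q * s)) * (h₂ * h₂)
      + (pow q 5 * pow s 3) * (h₃ * h₃) ≈ 0#
  squares-vanish {x} {q} {s} {h₀} {h₁} {h₂} {h₃} eq₀ eq₁ = a+d≈b+c⇒a-b-c+d≈0 (begin
    h₀ * h₀ + (pow q 5 * pow s 3) * (h₃ * h₃)
      ≈⟨ +-congʳ (*-cong eq₀′ eq₀′) ⟩
    A * A + (pow q 5 * pow s 3) * (h₃ * h₃)
      ≈⟨ solve 5 (λ x q s h₂ h₃ →
           let B = x :* h₂ :+ (q :* (q :* s)) :* h₃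
               A = x :* B :+ (q :* s) :* h₂
           in A :* A :+ (q :^ 5 :* s :^ 3) :* (h₃ :* h₃)
              := (x :* x :+ q :* s) :* (B :* B) :+ ((q :* s) :* (x :* x :+ q :* s)) :* (h₂ :* h₂))
         refl x q s h₂ h₃ ⟩
    (x * x + q * s) * (B * B) + ((q * s) * (x * x + q * s)) * (h₂ * h₂)
      ≈⟨ +-congʳ (*-congˡ (sym (*-cong eq₁ eq₁))) ⟩
    (x * x + q * s) * (h₁ * h₁) + ((q * s) * (x * x + q * s)) * (h₂ * h₂)  ∎)
    where
    B = x * h₂ + (q * (q * s)) * h₃
    A = x * B + (q * s) * h₂
    eq₀′ : h₀ ≈ A
    eq₀′ = trans eq₀ (+-congʳ (*-congˡ eq₁))

mainTheorem2 : {c ℓ : Level} (R : CommutativeRing c ℓ) →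
    let open QFib R in
    (q q⁻ x s s⁻ : Carrier) → q * q⁻ ≈ 1# → s * s⁻ ≈ 1# → (n : ℤ) →
    ((f q n x s s⁻ * f q n x s s⁻
    - (x * x + q * s) * (f q (n -ℤ + 1) x (q * s) (q⁻ * s⁻) * f q (n -ℤ + 1) x (q * s) (q⁻ * s⁻)))
    - ((q * s) * (x * x + q * s)) * (f q (n -ℤ + 2) x (pow q 2 * s) (pow q⁻ 2 * s⁻) * f q (n -ℤ + 2) x (pow q 2 * s) (pow q⁻ 2 * s⁻)))
    + (pow q 5 * pow s 3) * (f q (n -ℤ + 3) x (pow q 3 * s) (pow q⁻ 3 * s⁻) * f q (n -ℤ + 3) x (pow q 3 * s) (pow q⁻ 3 * s⁻))
    ≈ 0#
mainTheorem2 R q q⁻ x s s⁻ qq⁻ ss⁻ n = squares-vanish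
  (trans (f-shift qq⁻ x ss⁻ n)
         (+-congˡ (*-congˡ (f-cong q x {n -ℤ + 2} ≡.refl (pow²-* q s) (pow²-* q⁻ s⁻)))))
  (trans (f-shift qq⁻ x (*-inverse qq⁻ ss⁻) (n -ℤ + 1))
         (+-cong (*-congˡ (f-cong q x (ℤ.+-assoc n _ _) (pow²-* q s) (pow²-* q⁻ s⁻)))
                 (*-congˡ (f-cong q x (ℤ.+-assoc n _ _) (pow³-* q s) (pow³-* q⁻ s⁻)))))
  where
  open QFib R
  open Carlitz R
  open Shift using (f-shift)
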